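{- Fix $n\ge1$, let $\delta=(n,n-1,\ldots,1)$, and let $\mu\subseteq\lambda$ be partitions with $\mu\subseteq\delta$ and $\ell(\lambda)\le n$. For any subsets $I,I'\subseteq\mathbb{N}$ there is a bijection from $\mathbf{Q}(\lambda/\mu,I)$ to $\mathbf{Q}(\lambda/\mu,I')$ that preserves both $wt(T)$ and $P(T)$.
   Context: For $I\subseteq\mathbb{N}$, define the total order $\le_I$ on the alphabet $\{1',1,2',2,\ldots\}$ by: if $i<j$ then each of $i,i'$ is less than each of $j,j'$; if $i\in I$ then $i<_I i'$; if $i\notin I$ then $i'<_I i$. A generalized $Q$-tableau of shape $\lambda/\mu$ and set $I$ is a filling of the (unshifted) Young diagram $\lambda/\mu$ with letters from this alphabet such that rows and columns are weakly increasing with respect to $\le_I$, no primed letter appears more than once in any row, and no unprimed letter appears more than once in any column. $\mathbf{Q}(\lambda/\mu,I)$ denotes the set of these. $wt(T)$ is the vector whose $i$-th coordinate is the number of entries equal to $i$ or $i'$, and $P(T)$ is the number of primed entries. -}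

module Defs where

open import Data.Nat using (ℕ; zero; suc; _+_; _∸_; _≤_; _<_; _≥_; _≟_)
open import Data.Bool using (Bool; true; false)
open import Data.Product using (Σ; _×_; _,_; proj₁; proj₂)
open import Data.Sum using (_⊎_)
open import Data.List using (List; []; _∷_; length; map; concatMap; upTo; filter)
open import Data.List.Relation.Unary.All using (All)
open import Data.List.Relation.Unary.Linked using (Linked)
open import Relation.Binary.PropositionalEquality using (_≡_; refl; sym; trans)
open import Relation.Binary.Bundles using (Setoid)
open import Relation.Nullary using (¬_)
open import Relation.Nullary.Decidable using (⌊_⌋)
open import Data.Bool using (T)
import Data.Bool as B

-- Partitions: finite lists of positive parts, weakly decreasing.
-- ℓ(λ) = length λ.  Rows are indexed from 0.

IsPartition : List ℕ → Set
IsPartition la = Linked _≥_ la × All (λ k → 0 < k) la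

part : List ℕ → ℕ → ℕ
part []       _       = 0
part (x ∷ _)  zero    = x
part (_ ∷ xs) (suc r) = part xs r

_⊆P_ : List ℕ → List ℕ → Set
mu ⊆P la = ∀ r → part mu r ≤ part la r

staircase : ℕ → List ℕ
staircase zero    = []
staircase (suc n) = suc n ∷ staircase n

Subset : Set
Subset = ℕ → Bool

-- Letters of the alphabet {1',1,2',2,...}: (i , primed?).
Letter : Set
Letter = ℕ × Bool

val : Letter → ℕ
val = proj₁

primed : Letter → Bool
primed = proj₂

data _≤[_]_ : Letter → Subset → Letter → Set where
  lt       : ∀ {I i j p q} → i < j → (i , p) ≤[ I ] (j , q)
  same     : ∀ {I i p} → (i , p) ≤[ I ] (i , p)
  unpr<pr  : ∀ {I i} → I i ≡ true  → (i , false) ≤[ I ] (i , true)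
  pr<unpr  : ∀ {I i} → I i ≡ false → (i , true)  ≤[ I ] (i , false)

InShape : List ℕ → List ℕ → ℕ → ℕ → Set
InShape la mu r c = part mu r ≤ c × c < part la r

-- the list of cells of λ/μ (each exactly once, when μ ⊆ λ)
cells : List ℕ → List ℕ → List (ℕ × ℕ)
cells la mu = concatMap (λ r → map (λ k → (r , part mu r + k)) (upTo (part la r ∸ part mu r)))
                        (upTo (length la))

-- A filling assigns a letter to every position; only cells of λ/μ matter.
Filling : Set
Filling = ℕ → ℕ → Letter

record IsQTab (la mu : List ℕ) (I : Subset) (F : Filling) : Set where
  field
    letters  : ∀ r c → InShape la mu r c → 1 ≤ val (F r c)
    rowIncr  : ∀ r c c' → InShape la mu r c → InShape la mu r c' → c < c' →
               F r c ≤[ I ] F r c'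
    colIncr  : ∀ r r' c → InShape la mu r c → InShape la mu r' c → r < r' →
               F r c ≤[ I ] F r' c
    rowPrime : ∀ r c c' → InShape la mu r c → InShape la mu r c' → c < c' →
               F r c ≡ F r c' → primed (F r c) ≡ false
    colUnpr  : ∀ r r' c → InShape la mu r c → InShape la mu r' c → r < r' →
               F r c ≡ F r' c → primed (F r c) ≡ true

QTab : List ℕ → List ℕ → Subset → Set
QTab la mu I = Σ Filling (IsQTab la mu I)

_≈Q_ : ∀ {la mu I} → QTab la mu I → QTab la mu I → Set
_≈Q_ {la} {mu} (F , _) (G , _) = ∀ r c → InShape la mu r c → F r c ≡ G r c

𝐐 : List ℕ → List ℕ → Subset → Setoid _ _
𝐐 la mu I = record
  { Carrier = QTab la mu I
  ; _≈_ = _≈Q_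
  ; isEquivalence = record
    { refl  = λ r c _ → refl
    ; sym   = λ p r c s → sym (p r c s)
    ; trans = λ p q r c s → trans (p r c s) (q r c s)
    }
  }

wt : ∀ {la mu I} → QTab la mu I → ℕ → ℕ
wt {la} {mu} (F , _) i = length (filter (λ rc → val (F (proj₁ rc) (proj₂ rc)) ≟ i) (cells la mu))

P : ∀ {la mu I} → QTab la mu I → ℕ
P {la} {mu} (F , _) =
  length (filter (λ rc → primed (F (proj₁ rc) (proj₂ rc)) B.≟ true) (cells la mu))

-- Fix a tableau T and a value i.  Call two cells of λ/μ linked when they are
-- horizontally or vertically adjacent and both carry the value i.  The cells carrying i
-- contain no 2×2 square, so every linked component (a strip) is a ribbon, read from its
-- bottom-left end to its top-right end: each cell is followed by its right neighbour if
-- that is linked to it, and otherwise by its upper neighbour.  When the status of i changes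
-- (i leaves or enters I) we rotate the entries of every i-strip cyclically by one cell,
-- forwards or backwards; when it does not change we do nothing.  The new tableau is T ∘ σ
-- for a permutation σ of the cells that preserves values, whose inverse is the rotation
-- for the opposite change; hence wt is preserved pointwise and P because counting primes
-- over a permuted list of cells gives the same number.

module Submission where

open import Defs
open import Data.Nat using (ℕ; suc; _≤_)
open import Data.List using (List; length)
open import Data.Product using (Σ; _×_)
open import Relation.Binary.PropositionalEquality using (_≡_)
open import Function.Bundles using (Bijection)

open import Data.Nat using (zero; _+_; _∸_; _<_; _≥_; z≤n; s≤s; _≤?_; _<?_; _≟_)
open import Data.Nat.Properties
  using ( ≤-refl; ≤-trans; ≤-antisym; ≤-reflexive; <-trans; <-≤-trans; ≤-<-trans; <⇒≤
        ; <-irrefl; n≤1+n; n<1+n; n≮0; m≤m+n; +-identityʳ; +-suc; +-cancelˡ-≡; +-monoʳ-<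
        ; +-∸-assoc; m+[n∸m]≡n; ∸-monoˡ-<; m∸n≢0⇒n<m; m≤n⇒∃[o]m+o≡n; m≤n⇒m<n∨m≡n
        ; 1+n≢0; suc-injective )
open import Data.Bool using (Bool; true; false)
import Data.Bool as B
open import Data.Maybe using (Maybe; just; nothing; fromMaybe)
open import Data.Product using (_,_; proj₁; proj₂)
open import Data.Sum using (inj₁; inj₂)
open import Data.Empty using (⊥; ⊥-elim)
open import Data.List using ([]; _∷_; map; filter; upTo; applyUpTo)
open import Data.List.Membership.Propositional using (_∈_; find; lose)
open import Data.List.Membership.Propositional.Properties
  using (∈-map⁺; ∈-map⁻; ∈-concatMap⁺; ∈-concatMap⁻; ∈-upTo⁺; ∈-upTo⁻)
open import Data.List.Membership.Propositional.Properties.WithK using (unique∧set⇒bag)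
open import Data.List.Relation.Unary.All using (All; []; _∷_; universal)
import Data.List.Relation.Unary.All.Properties as Allₚ
open import Data.List.Relation.Unary.Any using (here; there)
open import Data.List.Relation.Unary.AllPairs using ([]; _∷_)
import Data.List.Relation.Unary.AllPairs as AllPairs
import Data.List.Relation.Unary.AllPairs.Properties as AllPairsₚ
open import Data.List.Relation.Unary.Linked using (Linked; _∷_)
open import Data.List.Relation.Unary.Unique.Propositional using (Unique)
open import Data.List.Relation.Unary.Unique.Propositional.Properties using (concat⁺; map⁺; upTo⁺)
open import Data.List.Relation.Binary.BagAndSetEquality using (∼bag⇒↭)
open import Data.List.Relation.Binary.Permutation.Propositional.Properties
  using (filter-↭; ↭-length)
open import Relation.Binary.PropositionalEquality
  using (refl; sym; trans; cong; cong₂; subst; subst₂)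
open import Relation.Nullary using (Dec; yes; no; ¬_; does)
open import Relation.Nullary.Decidable using (_×-dec_)
open import Relation.Unary using (Pred; Decidable)
open import Function.Bundles using (mk⇔)

-- (1) Counting over a permuted list

module _ {A B : Set} {ℓ} {Good : Pred B ℓ} (good? : Decidable Good) where

  length-filter-map : (σ : A → B) (xs : List A) →
    length (filter good? (map σ xs)) ≡ length (filter (λ x → good? (σ x)) xs)
  length-filter-map σ [] = refl
  length-filter-map σ (x ∷ xs) with does (good? (σ x))
  ... | true  = cong suc (length-filter-map σ xs)
  ... | false = length-filter-map σ xs

module _ {A : Set} where

  map-Unique-on : (σ : A → A) {xs : List A} →
    (∀ {x y} → x ∈ xs → y ∈ xs → σ x ≡ σ y → x ≡ y) → Unique xs → Unique (map σ xs)
  map-Unique-on σ inj [] = []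
  map-Unique-on σ {x ∷ xs} inj (x∉xs ∷ u) =
    images xs (λ y∈ → inj (here refl) (there y∈)) x∉xs ∷ map-Unique-on σ (λ a b → inj (there a) (there b)) u
    where
    images : ∀ ys → (∀ {y} → y ∈ ys → σ x ≡ σ y → x ≡ y) →
             All (λ y → ¬ x ≡ y) ys → All (λ y → ¬ σ x ≡ y) (map σ ys)
    images [] _ [] = []
    images (y ∷ ys) h (x≢y ∷ rest) = (λ e → x≢y (h (here refl) e)) ∷ images ys (λ m → h (there m)) rest

  count-permute : ∀ {ℓ} {Good : Pred A ℓ} (good? : Decidable Good) (σ τ : A → A) (xs : List A) →
    Unique xs → (∀ {x} → x ∈ xs → σ x ∈ xs) → (∀ {x} → x ∈ xs → τ x ∈ xs) →
    (∀ {x} → x ∈ xs → σ (τ x) ≡ x) → (∀ {x} → x ∈ xs → τ (σ x) ≡ x) →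
    length (filter (λ x → good? (σ x)) xs) ≡ length (filter good? xs)
  count-permute good? σ τ xs u σ∈ τ∈ στ τσ =
    trans (sym (length-filter-map good? σ xs))
          (↭-length (filter-↭ good? (∼bag⇒↭ (unique∧set⇒bag σxs-unique u (mk⇔ to from)))))
    where
    σxs-unique : Unique (map σ xs)
    σxs-unique = map-Unique-on σ (λ x∈ y∈ e → trans (sym (τσ x∈)) (trans (cong τ e) (τσ y∈))) u
    to : ∀ {z} → z ∈ map σ xs → z ∈ xs
    to z∈ with ∈-map⁻ σ z∈
    ... | x , x∈ , refl = σ∈ x∈
    from : ∀ {z} → z ∈ xs → z ∈ map σ xs
    from {z} z∈ = subst (_∈ map σ xs) (στ z∈) (∈-map⁺ σ (τ∈ z∈))

count-value-cong : {A : Set} (f g : A → ℕ) (i : ℕ) (xs : List A) → (∀ {x} → x ∈ xs → f x ≡ g x) →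
  length (filter (λ x → f x ≟ i) xs) ≡ length (filter (λ x → g x ≟ i) xs)
count-value-cong f g i [] _ = refl
count-value-cong f g i (x ∷ xs) agree with f x | agree (here refl)
... | .(g x) | refl with does (g x ≟ i)
...   | true  = cong suc (count-value-cong f g i xs (λ m → agree (there m)))
...   | false = count-value-cong f g i xs (λ m → agree (there m))

-- (2) Skew shapes

part-suc≤part : ∀ la → Linked _≥_ la → ∀ r → part la (suc r) ≤ part la r
part-suc≤part [] _ r = z≤n
part-suc≤part (x ∷ []) _ zero = z≤n
part-suc≤part (x ∷ []) _ (suc r) = z≤n
part-suc≤part (x ∷ y ∷ la) (x≥y ∷ _) zero = x≥y
part-suc≤part (x ∷ y ∷ la) (_ ∷ l) (suc r) = part-suc≤part (y ∷ la) l r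

part-antitone : ∀ la → Linked _≥_ la → ∀ {r r'} → r ≤ r' → part la r' ≤ part la r
part-antitone la l {r} r≤r' with m≤n⇒∃[o]m+o≡n r≤r'
... | o , refl = down o
  where
  down : ∀ o → part la (r + o) ≤ part la r
  down zero rewrite +-identityʳ r = ≤-refl
  down (suc o) rewrite +-suc r o = ≤-trans (part-suc≤part la l (r + o)) (down o)

part-pos⇒row< : ∀ la r → 0 < part la r → r < length la
part-pos⇒row< (x ∷ la) zero _ = s≤s z≤n
part-pos⇒row< (x ∷ la) (suc r) p = s≤s (part-pos⇒row< la r p)

InShape? : ∀ la mu r c → Dec (InShape la mu r c)
InShape? la mu r c = (part mu r ≤? c) ×-dec (c <? part la r)

row<length : ∀ {la mu r c} → InShape la mu r c → r < length la
row<length {la} {r = r} (_ , c<) = part-pos⇒row< la r (≤-<-trans z≤n c<)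

col<part₀ : ∀ {la mu r c} → IsPartition la → InShape la mu r c → c < part la 0
col<part₀ {la} pla (_ , c<) = <-≤-trans c< (part-antitone la (proj₁ pla) z≤n)

module CellList (la mu : List ℕ) where

  row : ℕ → List (ℕ × ℕ)
  row r = map (λ k → (r , part mu r + k)) (upTo (part la r ∸ part mu r))

  cells-sound : ∀ {x} → x ∈ cells la mu → InShape la mu (proj₁ x) (proj₂ x)
  cells-sound x∈ with find (∈-concatMap⁻ row {xs = upTo (length la)} x∈)
  ... | r , _ , x∈row with ∈-map⁻ _ x∈row
  ... | k , k∈ , refl = m≤m+n (part mu r) k , subst (part mu r + k <_) (m+[n∸m]≡n μ≤λ) (+-monoʳ-< (part mu r) k<)
    where
    k< : k < part la r ∸ part mu r
    k< = ∈-upTo⁻ k∈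
    μ≤λ : part mu r ≤ part la r
    μ≤λ = <⇒≤ (m∸n≢0⇒n<m (λ e → n≮0 (subst (k <_) e k<)))

  cells-complete : ∀ {r c} → InShape la mu r c → (r , c) ∈ cells la mu
  cells-complete {r} {c} s@(μ≤c , c<λ) = ∈-concatMap⁺ row {xs = upTo (length la)}
    (lose (∈-upTo⁺ (row<length {la} {mu} s))
          (subst (λ z → (r , z) ∈ row r) (m+[n∸m]≡n μ≤c) (∈-map⁺ _ (∈-upTo⁺ (∸-monoˡ-< c<λ μ≤c)))))

  cells-unique : Unique (cells la mu)
  cells-unique = concat⁺ (Allₚ.map⁺ (universal rowUnique (upTo (length la))))
                         (AllPairsₚ.map⁺ (AllPairs.map rowsDisjoint (upTo⁺ (length la))))
    where
    rowUnique : ∀ r → Unique (row r)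
    rowUnique r = map⁺ (λ e → +-cancelˡ-≡ (part mu r) _ _ (cong proj₂ e)) (upTo⁺ _)
    rowsDisjoint : ∀ {r r'} → ¬ r ≡ r' → ∀ {x} → ¬ (x ∈ row r × x ∈ row r')
    rowsDisjoint r≢r' (x∈ , x∈') with ∈-map⁻ _ x∈ | ∈-map⁻ _ x∈'
    ... | _ , _ , refl | _ , _ , e = r≢r' (cong proj₁ e)

-- (3) Snapshots: finite tables of the values of a filling on λ/μ.  The rotation σ is
-- computed from a snapshot, so that fillings agreeing on λ/μ get literally the same σ.

Table : Set
Table = List (List ℕ)

index : {A : Set} → A → List A → ℕ → A
index d [] _ = d
index d (x ∷ xs) zero = x
index d (x ∷ xs) (suc i) = index d xs i

index-applyUpTo : {A : Set} (d : A) (f : ℕ → A) {n i : ℕ} → i < n → index d (applyUpTo f n) i ≡ f i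
index-applyUpTo d f {suc n} {zero} _ = refl
index-applyUpTo d f {suc n} {suc i} (s≤s i<n) = index-applyUpTo d (λ j → f (suc j)) i<n

applyUpTo-cong : {A : Set} (f g : ℕ → A) (n : ℕ) → (∀ i → i < n → f i ≡ g i) → applyUpTo f n ≡ applyUpTo g n
applyUpTo-cong f g zero _ = refl
applyUpTo-cong f g (suc n) f≗g =
  cong₂ _∷_ (f≗g 0 (s≤s z≤n)) (applyUpTo-cong (λ i → f (suc i)) (λ i → g (suc i)) n (λ i p → f≗g (suc i) (s≤s p)))

entry : Table → ℕ → ℕ → ℕ
entry t r c = index 0 (index [] t r) c

module Snapshot (la mu : List ℕ) where

  restrict : (ℕ → ℕ → ℕ) → ℕ → ℕ → ℕ
  restrict v r c with InShape? la mu r c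
  ... | yes _ = v r c
  ... | no _ = 0

  snapshot : (ℕ → ℕ → ℕ) → Table
  snapshot v = applyUpTo (λ r → applyUpTo (λ c → restrict v r c) (part la 0)) (length la)

  restrict-inside : ∀ v r c → InShape la mu r c → restrict v r c ≡ v r c
  restrict-inside v r c s with InShape? la mu r c
  ... | yes _ = refl
  ... | no ¬s = ⊥-elim (¬s s)

  entry-snapshot : IsPartition la → ∀ v r c → InShape la mu r c → entry (snapshot v) r c ≡ v r c
  entry-snapshot pla v r c s =
    trans (cong (λ row → index 0 row c) (index-applyUpTo [] restrictedRow (row<length {la} {mu} s)))
          (trans (index-applyUpTo 0 (restrict v r) (col<part₀ {mu = mu} pla s)) (restrict-inside v r c s))
    where
    restrictedRow : ℕ → List ℕ
    restrictedRow r = applyUpTo (λ c → restrict v r c) (part la 0)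

  snapshot-cong : ∀ v w → (∀ r c → InShape la mu r c → v r c ≡ w r c) → snapshot v ≡ snapshot w
  snapshot-cong v w agree =
    applyUpTo-cong _ _ _ (λ r _ → applyUpTo-cong _ _ _ (λ c _ → restrict-cong r c))
    where
    restrict-cong : ∀ r c → restrict v r c ≡ restrict w r c
    restrict-cong r c with InShape? la mu r c
    ... | yes s = agree r c s
    ... | no _ = refl

-- (4) Strips of a value function W on λ/μ and their cyclic rotations

Pos : Set
Pos = ℕ × ℕ

_at_ : Filling → Pos → Letter
F at (r , c) = F r c

module Strips (la mu : List ℕ) (W : ℕ → ℕ → ℕ) where

  Same : Pos → Pos → Set
  Same (r , c) (r' , c') = InShape la mu r c × InShape la mu r' c' × W r c ≡ W r' c'

  same? : ∀ x y → Dec (Same x y)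
  same? (r , c) (r' , c') = InShape? la mu r c ×-dec (InShape? la mu r' c' ×-dec (W r c ≟ W r' c'))

  upper? : ℕ → ℕ → Maybe Pos
  upper? zero c = nothing
  upper? (suc r) c with same? (suc r , c) (r , c)
  ... | yes _ = just (r , c)
  ... | no _ = nothing

  succ? : Pos → Maybe Pos
  succ? (r , c) with same? (r , c) (r , suc c)
  ... | yes _ = just (r , suc c)
  ... | no _ = upper? r c

  lower? : ℕ → ℕ → Maybe Pos
  lower? r c with same? (r , c) (suc r , c)
  ... | yes _ = just (suc r , c)
  ... | no _ = nothing

  pred? : Pos → Maybe Pos
  pred? (r , zero) = lower? r zero
  pred? (r , suc c) with same? (r , suc c) (r , c)
  ... | yes _ = just (r , c)
  ... | no _ = lower? r (suc c)

  NoLeft : ℕ → ℕ → Set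
  NoLeft r c = ∀ d → c ≡ suc d → ¬ Same (r , c) (r , d)

  data SuccView (r c : ℕ) : Maybe Pos → Set where
    right : Same (r , c) (r , suc c) → SuccView r c (just (r , suc c))
    up    : ∀ {r'} → r ≡ suc r' → ¬ Same (r , c) (r , suc c) → Same (r , c) (r' , c) →
            SuccView r c (just (r' , c))
    none  : ¬ Same (r , c) (r , suc c) → (∀ r' → r ≡ suc r' → ¬ Same (r , c) (r' , c)) →
            SuccView r c nothing

  data PredView (r c : ℕ) : Maybe Pos → Set where
    left : ∀ {d} → c ≡ suc d → Same (r , c) (r , d) → PredView r c (just (r , d))
    down : NoLeft r c → Same (r , c) (suc r , c) → PredView r c (just (suc r , c))
    none : NoLeft r c → ¬ Same (r , c) (suc r , c) → PredView r c nothing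

  succ-view : ∀ r c → SuccView r c (succ? (r , c))
  succ-view r c with same? (r , c) (r , suc c)
  ... | yes s = right s
  ... | no ¬s = upper-view r ¬s
    where
    upper-view : ∀ r → ¬ Same (r , c) (r , suc c) → SuccView r c (upper? r c)
    upper-view zero ¬s = none ¬s (λ _ ())
    upper-view (suc r) ¬s with same? (suc r , c) (r , c)
    ... | yes s = up refl ¬s s
    ... | no ¬u = none ¬s (λ { _ refl → ¬u })

  pred-view : ∀ r c → PredView r c (pred? (r , c))
  pred-view r zero = lower-view (λ _ ())
    where
    lower-view : NoLeft r zero → PredView r zero (lower? r zero)
    lower-view nl with same? (r , zero) (suc r , zero)
    ... | yes s = down nl s
    ... | no ¬s = none nl ¬s
  pred-view r (suc c) with same? (r , suc c) (r , c)
  ... | yes s = left refl s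
  ... | no ¬s = lower-view (λ { _ refl → ¬s })
    where
    lower-view : NoLeft r (suc c) → PredView r (suc c) (lower? r (suc c))
    lower-view nl with same? (r , suc c) (suc r , suc c)
    ... | yes s = down nl s
    ... | no ¬d = none nl ¬d

  -- Measures that drop by exactly one along succ? and along pred? respectively.
  toEnd toStart : Pos → ℕ
  toEnd (r , c) = r + (part la 0 ∸ c)
  toStart (r , c) = c + (length la ∸ r)

  forward backward : ℕ → Pos → Pos
  forward zero x = x
  forward (suc k) x with succ? x
  ... | just y = forward k y
  ... | nothing = x
  backward zero x = x
  backward (suc k) x with pred? x
  ... | just y = backward k y
  ... | nothing = x

  end start : Pos → Pos
  end x = forward (toEnd x) x
  start x = backward (toStart x) x

  cyclicPred cyclicSucc : Pos → Pos
  cyclicPred x = fromMaybe (end x) (pred? x)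
  cyclicSucc x = fromMaybe (start x) (succ? x)

  -- The cell whose entry is moved to x when the membership of its value changes from b to b':
  -- entries move one step forward when it leaves, one step back when it enters.
  relocate : Bool → Bool → Pos → Pos
  relocate true  true  x = x
  relocate false false x = x
  relocate true  false x = cyclicPred x
  relocate false true  x = cyclicSucc x

  shift : Subset → Subset → Pos → Pos
  shift I I' (r , c) = relocate (I (W r c)) (I' (W r c)) (r , c)

  relocate-kept : ∀ {b b'} x → b ≡ b' → relocate b b' x ≡ x
  relocate-kept {true} x refl = refl
  relocate-kept {false} x refl = refl

  module EndPoints (pla : IsPartition la) where

    toEnd-succ : ∀ x y → succ? x ≡ just y → toEnd x ≡ suc (toEnd y)
    toEnd-succ (r , c) y e with succ? (r , c) | succ-view r c
    ... | .(just (r , suc c)) | right s with refl ← e =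
          trans (cong (r +_) (+-∸-assoc 1 (<⇒≤ (col<part₀ {mu = mu} pla (proj₁ (proj₂ s)))))) (+-suc r _)
    ... | .(just (_ , c)) | up refl _ _ with refl ← e = refl

    toStart-pred : ∀ x y → pred? x ≡ just y → toStart x ≡ suc (toStart y)
    toStart-pred (r , c) y e with pred? (r , c) | pred-view r c
    ... | .(just (r , _)) | left refl _ with refl ← e = refl
    ... | .(just (suc r , c)) | down _ s with refl ← e =
          trans (cong (c +_) (+-∸-assoc 1 (<⇒≤ (row<length {la} {mu} (proj₁ (proj₂ s)))))) (+-suc c _)

    end-step : ∀ x y → succ? x ≡ just y → end x ≡ end y
    end-step x y e rewrite toEnd-succ x y e | e = refl

    end-stop : ∀ x → succ? x ≡ nothing → end x ≡ x
    end-stop x e with toEnd x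
    ... | zero = refl
    ... | suc k rewrite e = refl

    start-step : ∀ x y → pred? x ≡ just y → start x ≡ start y
    start-step x y e rewrite toStart-pred x y e | e = refl

    start-stop : ∀ x → pred? x ≡ nothing → start x ≡ x
    start-stop x e with toStart x
    ... | zero = refl
    ... | suc k rewrite e = refl

-- (5) The order ≤_J on letters of one value i: the smaller of i, i' is i when i ∈ J and
-- i' when i ∉ J.

true≢false : true ≡ false → ⊥
true≢false ()

status : ∀ {J : Subset} {w w' b} → w ≡ w' → J w ≡ b → J w' ≡ b
status refl p = p

≤-val : ∀ {J a b} → a ≤[ J ] b → val a ≤ val b
≤-val (lt p) = <⇒≤ p
≤-val same = ≤-refl
≤-val (unpr<pr _) = ≤-refl
≤-val (pr<unpr _) = ≤-refl

val<⇒≤ : ∀ {J} {a b : Letter} → val a < val b → a ≤[ J ] b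
val<⇒≤ {a = i , p} {b = j , q} i<j = lt i<j

≤-transport : ∀ {J J' a b} → a ≤[ J ] b → val a ≡ val b → J (val a) ≡ J' (val a) → a ≤[ J' ] b
≤-transport (lt p) e _ = ⊥-elim (<-irrefl e p)
≤-transport same _ _ = same
≤-transport (unpr<pr x) _ e = unpr<pr (trans (sym e) x)
≤-transport (pr<unpr x) _ e = pr<unpr (trans (sym e) x)

smaller-unprimed : ∀ {J a b} → a ≤[ J ] b → val a ≡ val b → J (val a) ≡ true →
  (a ≡ b → primed a ≡ false) → primed a ≡ false
smaller-unprimed (lt p) e _ _ = ⊥-elim (<-irrefl e p)
smaller-unprimed same _ _ h = h refl
smaller-unprimed (unpr<pr _) _ _ _ = refl
smaller-unprimed (pr<unpr x) _ t _ = ⊥-elim (true≢false (trans (sym t) x))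

larger-unprimed : ∀ {J a b} → a ≤[ J ] b → val a ≡ val b → J (val a) ≡ false →
  (a ≡ b → primed a ≡ false) → primed b ≡ false
larger-unprimed (lt p) e _ _ = ⊥-elim (<-irrefl e p)
larger-unprimed same _ _ h = h refl
larger-unprimed (unpr<pr x) _ f _ = ⊥-elim (true≢false (trans (sym x) f))
larger-unprimed (pr<unpr _) _ _ _ = refl

larger-primed : ∀ {J a b} → a ≤[ J ] b → val a ≡ val b → J (val a) ≡ true →
  (a ≡ b → primed a ≡ true) → primed b ≡ true
larger-primed (lt p) e _ _ = ⊥-elim (<-irrefl e p)
larger-primed same _ _ h = h refl
larger-primed (unpr<pr _) _ _ _ = refl
larger-primed (pr<unpr x) _ t _ = ⊥-elim (true≢false (trans (sym t) x))

smaller-primed : ∀ {J a b} → a ≤[ J ] b → val a ≡ val b → J (val a) ≡ false →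
  (a ≡ b → primed a ≡ true) → primed a ≡ true
smaller-primed (lt p) e _ _ = ⊥-elim (<-irrefl e p)
smaller-primed same _ _ h = h refl
smaller-primed (unpr<pr x) _ f _ = ⊥-elim (true≢false (trans (sym x) f))
smaller-primed (pr<unpr _) _ _ _ = refl

≤-max-unprimed : ∀ {J} (a b : Letter) → val a ≡ val b → J (val a) ≡ false → primed b ≡ false → a ≤[ J ] b
≤-max-unprimed (i , true)  (.i , .false) refl f refl = pr<unpr f
≤-max-unprimed (i , false) (.i , .false) refl f refl = same

≤-max-primed : ∀ {J} (a b : Letter) → val a ≡ val b → J (val a) ≡ true → primed b ≡ true → a ≤[ J ] b
≤-max-primed (i , true)  (.i , .true) refl t refl = same
≤-max-primed (i , false) (.i , .true) refl t refl = unpr<pr t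

min-unprimed-≤ : ∀ {J} (a b : Letter) → val a ≡ val b → J (val a) ≡ true → primed a ≡ false → a ≤[ J ] b
min-unprimed-≤ (i , .false) (.i , true)  refl t refl = unpr<pr t
min-unprimed-≤ (i , .false) (.i , false) refl t refl = same

min-primed-≤ : ∀ {J} (a b : Letter) → val a ≡ val b → J (val a) ≡ false → primed a ≡ true → a ≤[ J ] b
min-primed-≤ (i , .true) (.i , true)  refl f refl = same
min-primed-≤ (i , .true) (.i , false) refl f refl = pr<unpr f

squeeze : ∀ {x y z} → x ≤ y → y ≤ z → x ≡ z → y ≡ x
squeeze x≤y y≤z refl = ≤-antisym y≤z x≤y

-- (6) Strips of a tableau.  W is any value function agreeing with the tableau on λ/μ.

module TableauStrips (la mu : List ℕ) (pla : IsPartition la) (pmu : IsPartition mu)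
    (I : Subset) (F : Filling) (Q : IsQTab la mu I F)
    (W : ℕ → ℕ → ℕ) (W-agrees : ∀ r c → InShape la mu r c → W r c ≡ val (F r c)) where

  open Strips la mu W public
  open EndPoints pla
  open IsQTab Q

  v : ℕ → ℕ → ℕ
  v r c = val (F r c)

  Ins : ℕ → ℕ → Set
  Ins = InShape la mu

  InS : Pos → Set
  InS (r , c) = Ins r c

  ins-right : ∀ {r c} → Ins r c → Ins (suc r) (suc c) → Ins r (suc c)
  ins-right {r} (μ≤ , _) (_ , <λ) = ≤-trans μ≤ (n≤1+n _) , <-≤-trans <λ (part-suc≤part la (proj₁ pla) r)

  ins-below : ∀ {r c} → Ins r c → Ins (suc r) (suc c) → Ins (suc r) c
  ins-below {r} (μ≤ , _) (_ , <λ) = ≤-trans (part-suc≤part mu (proj₁ pmu) r) μ≤ , <-trans (n<1+n _) <λ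

  ins-col : ∀ {r r' s c} → Ins r c → Ins r' c → r ≤ s → s ≤ r' → Ins s c
  ins-col (μ≤ , _) (_ , <λ) r≤s s≤r' =
    ≤-trans (part-antitone mu (proj₁ pmu) r≤s) μ≤ , <-≤-trans <λ (part-antitone la (proj₁ pla) s≤r')

  ins-row : ∀ {r c c' d} → Ins r c → Ins r c' → c ≤ d → d ≤ c' → Ins r d
  ins-row (μ≤ , _) (_ , <λ) c≤d d≤c' = ≤-trans μ≤ c≤d , ≤-<-trans d≤c' <λ

  rowLe : ∀ {r c c'} → Ins r c → Ins r c' → c ≤ c' → F r c ≤[ I ] F r c'
  rowLe {r} {c} {c'} s s' c≤c' with m≤n⇒m<n∨m≡n c≤c'
  ... | inj₁ c<c' = rowIncr r c c' s s' c<c'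
  ... | inj₂ refl = same

  colLe : ∀ {r r' c} → Ins r c → Ins r' c → r ≤ r' → F r c ≤[ I ] F r' c
  colLe {r} {r'} {c} s s' r≤r' with m≤n⇒m<n∨m≡n r≤r'
  ... | inj₁ r<r' = colIncr r r' c s s' r<r'
  ... | inj₂ refl = same

  Same⇒v≡ : ∀ {r c r' c'} → Same (r , c) (r' , c') → v r c ≡ v r' c'
  Same⇒v≡ {r} {c} {r'} {c'} (s , s' , e) = trans (sym (W-agrees r c s)) (trans e (W-agrees r' c' s'))

  v≡⇒Same : ∀ {r c r' c'} → Ins r c → Ins r' c' → v r c ≡ v r' c' → Same (r , c) (r' , c')
  v≡⇒Same {r} {c} {r'} {c'} s s' e = s , s' , trans (W-agrees r c s) (trans e (sym (W-agrees r' c' s')))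

  same-refl : ∀ x → InS x → Same x x
  same-refl (r , c) s = s , s , refl

  same-sym : ∀ {x y} → Same x y → Same y x
  same-sym (s , s' , e) = s' , s , sym e

  same-trans : ∀ {x y z} → Same x y → Same y z → Same x z
  same-trans (s , _ , e) (_ , s'' , e') = s , s'' , trans e e'

  -- The cells of one value contain no 2×2 square: the prime status of one of its
  -- off-diagonal corners would be forced both ways.
  no-square : ∀ {r c} → Ins r c → Ins (suc r) (suc c) → v r c ≡ v r (suc c) → v r c ≡ v (suc r) c →
              v r c ≡ v (suc r) (suc c) → ⊥
  no-square {r} {c} s₀₀ s₁₁ e₀₁ e₁₀ e₁₁ with I (v r c) in eI
  ... | true = true≢false (trans (sym below-primed) below-unprimed)
    where
    s₁₀ = ins-below s₀₀ s₁₁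
    below-primed : primed (F (suc r) c) ≡ true
    below-primed = larger-primed (colIncr r (suc r) c s₀₀ s₁₀ (n<1+n r)) e₁₀ eI
                                 (colUnpr r (suc r) c s₀₀ s₁₀ (n<1+n r))
    below-unprimed : primed (F (suc r) c) ≡ false
    below-unprimed = smaller-unprimed (rowIncr (suc r) c (suc c) s₁₀ s₁₁ (n<1+n c)) (trans (sym e₁₀) e₁₁)
                                      (status {J = I} e₁₀ eI) (rowPrime (suc r) c (suc c) s₁₀ s₁₁ (n<1+n c))
  ... | false = true≢false (trans (sym right-primed) right-unprimed)
    where
    s₀₁ = ins-right s₀₀ s₁₁
    right-unprimed : primed (F r (suc c)) ≡ false
    right-unprimed = larger-unprimed (rowIncr r c (suc c) s₀₀ s₀₁ (n<1+n c)) e₀₁ eI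
                                     (rowPrime r c (suc c) s₀₀ s₀₁ (n<1+n c))
    right-primed : primed (F r (suc c)) ≡ true
    right-primed = smaller-primed (colIncr r (suc r) (suc c) s₀₁ s₁₁ (n<1+n r)) (trans (sym e₀₁) e₁₁)
                                  (status {J = I} e₀₁ eI) (colUnpr r (suc r) (suc c) s₀₁ s₁₁ (n<1+n r))

  -- Hence a cell is not linked both to its left and to its lower neighbour, nor both to its
  -- upper and to its right neighbour (by monotonicity the fourth corner has the same value).
  no-left-and-down : ∀ {r c} → Same (r , suc c) (r , c) → Same (r , suc c) (suc r , suc c) → ⊥
  no-left-and-down {r} {c} linkL linkD =
    no-square s₀₀ s₁₁ (sym (Same⇒v≡ linkL)) e₁₀ (trans (sym (Same⇒v≡ linkL)) (Same⇒v≡ linkD))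
    where
    s₀₀ = proj₁ (proj₂ linkL)
    s₁₁ = proj₁ (proj₂ linkD)
    s₁₀ = ins-below s₀₀ s₁₁
    e₁₀ : v r c ≡ v (suc r) c
    e₁₀ = ≤-antisym (≤-val (colLe s₀₀ s₁₀ (n≤1+n r)))
            (≤-trans (≤-val (rowLe s₁₀ s₁₁ (n≤1+n c))) (≤-reflexive (trans (sym (Same⇒v≡ linkD)) (Same⇒v≡ linkL))))

  no-up-and-right : ∀ {r c} → Same (suc r , c) (r , c) → Same (suc r , c) (suc r , suc c) → ⊥
  no-up-and-right {r} {c} linkU linkR =
    no-square s₀₀ s₁₁ e₀₁ (sym (Same⇒v≡ linkU)) (trans (sym (Same⇒v≡ linkU)) (Same⇒v≡ linkR))
    where
    s₀₀ = proj₁ (proj₂ linkU)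
    s₁₁ = proj₁ (proj₂ linkR)
    s₀₁ = ins-right s₀₀ s₁₁
    e₀₁ : v r c ≡ v r (suc c)
    e₀₁ = ≤-antisym (≤-val (rowLe s₀₀ s₀₁ (n≤1+n c)))
            (≤-trans (≤-val (colLe s₀₁ s₁₁ (n≤1+n r))) (≤-reflexive (trans (sym (Same⇒v≡ linkR)) (Same⇒v≡ linkU))))

  pred-left : ∀ {r d} → Same (r , suc d) (r , d) → pred? (r , suc d) ≡ just (r , d)
  pred-left {r} {d} link with pred? (r , suc d) | pred-view r (suc d)
  ... | .(just (r , _)) | left refl _ = refl
  ... | .(just (suc r , suc d)) | down noLeft _ = ⊥-elim (noLeft d refl link)
  ... | .nothing | none noLeft _ = ⊥-elim (noLeft d refl link)

  pred-down : ∀ {r c} → Same (r , c) (suc r , c) → pred? (r , c) ≡ just (suc r , c)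
  pred-down {r} {c} link with pred? (r , c) | pred-view r c
  ... | .(just (r , _)) | left refl linkL = ⊥-elim (no-left-and-down linkL link)
  ... | .(just (suc r , c)) | down _ _ = refl
  ... | .nothing | none _ ¬link = ⊥-elim (¬link link)

  succ-right : ∀ {r c} → Same (r , c) (r , suc c) → succ? (r , c) ≡ just (r , suc c)
  succ-right {r} {c} link with succ? (r , c) | succ-view r c
  ... | .(just (r , suc c)) | right _ = refl
  ... | .(just (_ , c)) | up _ ¬link _ = ⊥-elim (¬link link)
  ... | .nothing | none ¬link _ = ⊥-elim (¬link link)

  succ-up : ∀ {r c} → Same (suc r , c) (r , c) → succ? (suc r , c) ≡ just (r , c)
  succ-up {r} {c} link with succ? (suc r , c) | succ-view (suc r) c
  ... | .(just (suc r , suc c)) | right linkR = ⊥-elim (no-up-and-right link linkR)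
  ... | .(just (_ , c)) | up refl _ _ = refl
  ... | .nothing | none _ ¬link = ⊥-elim (¬link r refl link)

  succ⇒pred : ∀ x y → succ? x ≡ just y → pred? y ≡ just x
  succ⇒pred (r , c) y e with succ? (r , c) | succ-view r c
  ... | .(just (r , suc c)) | right link with refl ← e = pred-left (same-sym link)
  ... | .(just (_ , c)) | up refl _ link with refl ← e = pred-down (same-sym link)

  pred⇒succ : ∀ x y → pred? y ≡ just x → succ? x ≡ just y
  pred⇒succ x (r , c) e with pred? (r , c) | pred-view r c
  ... | .(just (r , _)) | left refl link with refl ← e = succ-right (same-sym link)
  ... | .(just (suc r , c)) | down _ link with refl ← e = succ-up (same-sym link)

  succ-same : ∀ x y → succ? x ≡ just y → Same x y
  succ-same (r , c) y e with succ? (r , c) | succ-view r c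
  ... | .(just (r , suc c)) | right link with refl ← e = link
  ... | .(just (_ , c)) | up refl _ link with refl ← e = link

  pred-same : ∀ x y → pred? x ≡ just y → Same x y
  pred-same (r , c) y e with pred? (r , c) | pred-view r c
  ... | .(just (r , _)) | left refl link with refl ← e = link
  ... | .(just (suc r , c)) | down _ link with refl ← e = link

  end-spec : ∀ n x → toEnd x ≡ n → InS x →
             Same x (end x) × succ? (end x) ≡ nothing × start (end x) ≡ start x
  end-spec n x measure sx with succ? x in e
  ... | nothing rewrite end-stop x e = same-refl x sx , e , refl
  ... | just y with n
  ...   | zero = ⊥-elim (1+n≢0 (trans (sym (toEnd-succ x y e)) measure))
  ...   | suc m with end-spec m y (suc-injective (trans (sym (toEnd-succ x y e)) measure))
                                 (proj₁ (proj₂ (succ-same x y e)))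
  ...     | linked , stop , sameStart rewrite end-step x y e =
              same-trans (succ-same x y e) linked , stop , trans sameStart (start-step y x (succ⇒pred x y e))

  start-spec : ∀ n x → toStart x ≡ n → InS x →
               Same x (start x) × pred? (start x) ≡ nothing × end (start x) ≡ end x
  start-spec n x measure sx with pred? x in e
  ... | nothing rewrite start-stop x e = same-refl x sx , e , refl
  ... | just y with n
  ...   | zero = ⊥-elim (1+n≢0 (trans (sym (toStart-pred x y e)) measure))
  ...   | suc m with start-spec m y (suc-injective (trans (sym (toStart-pred x y e)) measure))
                                   (proj₁ (proj₂ (pred-same x y e)))
  ...     | linked , stop , sameEnd rewrite start-step x y e =
              same-trans (pred-same x y e) linked , stop , trans sameEnd (end-step y x (pred⇒succ y x e))

  cyclicPred-same : ∀ x → InS x → Same x (cyclicPred x)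
  cyclicPred-same x sx with pred? x in e
  ... | just y = pred-same x y e
  ... | nothing = proj₁ (end-spec _ x refl sx)

  cyclicSucc-same : ∀ x → InS x → Same x (cyclicSucc x)
  cyclicSucc-same x sx with succ? x in e
  ... | just y = succ-same x y e
  ... | nothing = proj₁ (start-spec _ x refl sx)

  cyclicSucc∘cyclicPred : ∀ x → InS x → cyclicSucc (cyclicPred x) ≡ x
  cyclicSucc∘cyclicPred x sx with pred? x in e
  ... | just y = cong (fromMaybe (start y)) (pred⇒succ y x e)
  ... | nothing with end-spec _ x refl sx
  ...   | _ , stop , sameStart = trans (cong (fromMaybe (start (end x))) stop) (trans sameStart (start-stop x e))

  cyclicPred∘cyclicSucc : ∀ x → InS x → cyclicPred (cyclicSucc x) ≡ x
  cyclicPred∘cyclicSucc x sx with succ? x in e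
  ... | just y = cong (fromMaybe (end y)) (succ⇒pred x y e)
  ... | nothing with start-spec _ x refl sx
  ...   | _ , stop , sameEnd = trans (cong (fromMaybe (end (start x))) stop) (trans sameEnd (end-stop x e))

  relocate-same : ∀ b b' x → InS x → Same x (relocate b b' x)
  relocate-same true  true  x sx = same-refl x sx
  relocate-same false false x sx = same-refl x sx
  relocate-same true  false x sx = cyclicPred-same x sx
  relocate-same false true  x sx = cyclicSucc-same x sx

  relocate-inverse : ∀ b b' x → InS x → relocate b' b (relocate b b' x) ≡ x
  relocate-inverse true  true  x sx = refl
  relocate-inverse false false x sx = refl
  relocate-inverse true  false x sx = cyclicSucc∘cyclicPred x sx
  relocate-inverse false true  x sx = cyclicPred∘cyclicSucc x sx

  shift-same : ∀ J J' x → InS x → Same x (shift J J' x)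
  shift-same J J' (r , c) sx = relocate-same (J (W r c)) (J' (W r c)) (r , c) sx

  -- shift J' J inverts shift J J' on λ/μ, since shifting preserves the value.
  shift-inverse : ∀ J J' x → InS x → shift J' J (shift J J' x) ≡ x
  shift-inverse J J' (r , c) sx =
    trans (cong (λ w → relocate (J' w) (J w) y) (sym (proj₂ (proj₂ (shift-same J J' (r , c) sx)))))
          (relocate-inverse (J (W r c)) (J' (W r c)) (r , c) sx)
    where
    y = shift J J' (r , c)

  -- (7) Rotating every strip whose value changes status gives a tableau for I'.

  module Rotated (I' : Subset) where

    σ : Pos → Pos
    σ = shift I I'

    F' : Filling
    F' r c = F at σ (r , c)

    val-F' : ∀ {r c} → Ins r c → val (F' r c) ≡ v r c
    val-F' {r} {c} s = sym (Same⇒v≡ (shift-same I I' (r , c) s))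

    σ-inside : ∀ {r c} → Ins r c → InS (σ (r , c))
    σ-inside {r} {c} s = proj₁ (proj₂ (shift-same I I' (r , c) s))

    Kept : ℕ → Set
    Kept w = I w ≡ I' w

    data Change (w : ℕ) : Set where
      kept    : Kept w → Change w
      dropped : I w ≡ true → I' w ≡ false → Change w
      added   : I w ≡ false → I' w ≡ true → Change w

    change : ∀ w → Change w
    change w with I w in eI | I' w in eI'
    ... | true  | true  = kept (trans eI (sym eI'))
    ... | false | false = kept (trans eI (sym eI'))
    ... | true  | false = dropped eI eI'
    ... | false | true  = added eI eI'

    σ-at : ∀ {r c} → Ins r c → σ (r , c) ≡ relocate (I (v r c)) (I' (v r c)) (r , c)
    σ-at {r} {c} s = cong (λ w → relocate (I w) (I' w) (r , c)) (W-agrees r c s)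

    F'-kept : ∀ {r c} → Ins r c → Kept (v r c) → F' r c ≡ F r c
    F'-kept {r} {c} s k = cong (F at_) (trans (σ-at s) (relocate-kept (r , c) k))

    σ-dropped : ∀ {r c} → Ins r c → I (v r c) ≡ true → I' (v r c) ≡ false → σ (r , c) ≡ cyclicPred (r , c)
    σ-dropped {r} {c} s t f = trans (σ-at s) (cong₂ (λ b b' → relocate b b' (r , c)) t f)

    σ-added : ∀ {r c} → Ins r c → I (v r c) ≡ false → I' (v r c) ≡ true → σ (r , c) ≡ cyclicSucc (r , c)
    σ-added {r} {c} s f t = trans (σ-at s) (cong₂ (λ b b' → relocate b b' (r , c)) f t)

    -- i leaves I: the entry moved to (r , c') comes from its left neighbour, which in T
    -- precedes an equal value in its row, so it is unprimed.
    dropped-row : ∀ {r c c'} → Ins r c → Ins r c' → c < c' → v r c ≡ v r c' →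
                  I (v r c) ≡ true → I' (v r c) ≡ false → primed (F' r c') ≡ false
    dropped-row {r} {c} {suc d} s s' (s≤s c≤d) e t f = trans (cong (λ x → primed (F at x)) moved) unprimed
      where
      sd = ins-row s s' c≤d (n≤1+n d)
      ed : v r d ≡ v r c
      ed = squeeze (≤-val (rowLe s sd c≤d)) (≤-val (rowLe sd s' (n≤1+n d))) e
      moved : σ (r , suc d) ≡ (r , d)
      moved = trans (σ-dropped s' (status {J = I} e t) (status {J = I'} e f))
                    (cong (fromMaybe (end (r , suc d))) (pred-left (v≡⇒Same s' sd (sym (trans ed e)))))
      unprimed : primed (F r d) ≡ false
      unprimed = smaller-unprimed (rowIncr r d (suc d) sd s' (n<1+n d)) (trans ed e)
                                  (status {J = I} (sym ed) t) (rowPrime r d (suc d) sd s' (n<1+n d))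

    -- i enters I: the entry moved to (r , c) comes from its right neighbour, which in T
    -- follows an equal value in its row, so it is unprimed.
    added-row : ∀ {r c c'} → Ins r c → Ins r c' → c < c' → v r c ≡ v r c' →
                I (v r c) ≡ false → I' (v r c) ≡ true → primed (F' r c) ≡ false
    added-row {r} {c} {c'} s s' c<c' e f t = trans (cong (λ x → primed (F at x)) moved) unprimed
      where
      sd = ins-row s s' (n≤1+n c) c<c'
      ed : v r (suc c) ≡ v r c
      ed = squeeze (≤-val (rowLe s sd (n≤1+n c))) (≤-val (rowLe sd s' c<c')) e
      moved : σ (r , c) ≡ (r , suc c)
      moved = trans (σ-added s f t) (cong (fromMaybe (start (r , c))) (succ-right (v≡⇒Same s sd (sym ed))))
      unprimed : primed (F r (suc c)) ≡ false
      unprimed = larger-unprimed (rowIncr r c (suc c) s sd (n<1+n c)) (sym ed) f (rowPrime r c (suc c) s sd (n<1+n c))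

    -- i leaves I: the entry moved to (r , c) comes from its lower neighbour, which in T
    -- follows an equal value in its column, so it is primed.
    dropped-col : ∀ {r r' c} → Ins r c → Ins r' c → r < r' → v r c ≡ v r' c →
                  I (v r c) ≡ true → I' (v r c) ≡ false → primed (F' r c) ≡ true
    dropped-col {r} {r'} {c} s s' r<r' e t f = trans (cong (λ x → primed (F at x)) moved) primed'
      where
      sd = ins-col s s' (n≤1+n r) r<r'
      ed : v (suc r) c ≡ v r c
      ed = squeeze (≤-val (colLe s sd (n≤1+n r))) (≤-val (colLe sd s' r<r')) e
      moved : σ (r , c) ≡ (suc r , c)
      moved = trans (σ-dropped s t f) (cong (fromMaybe (end (r , c))) (pred-down (v≡⇒Same s sd (sym ed))))
      primed' : primed (F (suc r) c) ≡ true
      primed' = larger-primed (colIncr r (suc r) c s sd (n<1+n r)) (sym ed) t (colUnpr r (suc r) c s sd (n<1+n r))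

    -- i enters I: the entry moved to (r' , c) comes from its upper neighbour, which in T
    -- precedes an equal value in its column, so it is primed.
    added-col : ∀ {r r' c} → Ins r c → Ins r' c → r < r' → v r c ≡ v r' c →
                I (v r c) ≡ false → I' (v r c) ≡ true → primed (F' r' c) ≡ true
    added-col {r} {suc d} {c} s s' (s≤s r≤d) e f t = trans (cong (λ x → primed (F at x)) moved) primed'
      where
      sd = ins-col s s' r≤d (n≤1+n d)
      ed : v d c ≡ v r c
      ed = squeeze (≤-val (colLe s sd r≤d)) (≤-val (colLe sd s' (n≤1+n d))) e
      moved : σ (suc d , c) ≡ (d , c)
      moved = trans (σ-added s' (status {J = I} e f) (status {J = I'} e t))
                    (cong (fromMaybe (start (suc d , c))) (succ-up (v≡⇒Same s' sd (sym (trans ed e)))))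
      primed' : primed (F d c) ≡ true
      primed' = smaller-primed (colIncr d (suc d) c sd s' (n<1+n d)) (trans ed e)
                               (status {J = I} (sym ed) f) (colUnpr d (suc d) c sd s' (n<1+n d))

    F'-val≡ : ∀ {r c r' c'} → Ins r c → Ins r' c' → v r c ≡ v r' c' → val (F' r c) ≡ val (F' r' c')
    F'-val≡ s s' e = trans (val-F' s) (trans e (sym (val-F' s')))

    F'≡⇒v≡ : ∀ {r c r' c'} → Ins r c → Ins r' c' → F' r c ≡ F' r' c' → v r c ≡ v r' c'
    F'≡⇒v≡ s s' eq = trans (sym (val-F' s)) (trans (cong val eq) (val-F' s'))

    I'-at : ∀ {r c b} → Ins r c → I' (v r c) ≡ b → I' (val (F' r c)) ≡ b
    I'-at s = status {J = I'} (sym (val-F' s))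

    strict-≤ : ∀ {r c r' c'} → Ins r c → Ins r' c' → v r c < v r' c' → F' r c ≤[ I' ] F' r' c'
    strict-≤ s s' v< = val<⇒≤ (subst₂ _<_ (sym (val-F' s)) (sym (val-F' s')) v<)

    kept-≤ : ∀ {r c r' c'} → Ins r c → Ins r' c' → v r c ≡ v r' c' → Kept (v r c) →
             F r c ≤[ I ] F r' c' → F' r c ≤[ I' ] F' r' c'
    kept-≤ s s' e k le =
      subst₂ (λ a b → a ≤[ I' ] b) (sym (F'-kept s k)) (sym (F'-kept s' (subst Kept e k))) (≤-transport le e k)

    kept-primed : ∀ {r c r' c' b} → Ins r c → Ins r' c' → Kept (v r c) → F' r c ≡ F' r' c' →
                  (F r c ≡ F r' c' → primed (F r c) ≡ b) → primed (F' r c) ≡ b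
    kept-primed s s' k eq inherited = trans (cong primed atFirst) (inherited (trans (sym atFirst) (trans eq atSecond)))
      where
      atFirst = F'-kept s k
      atSecond = F'-kept s' (subst Kept (F'≡⇒v≡ s s' eq) k)

    isQTab : IsQTab la mu I' F'
    isQTab = record { letters = letters' ; rowIncr = rowIncr' ; colIncr = colIncr'
                    ; rowPrime = rowPrime' ; colUnpr = colUnpr' }
      where
      letters' : ∀ r c → Ins r c → 1 ≤ val (F' r c)
      letters' r c s = subst (1 ≤_) (sym (val-F' s)) (letters r c s)

      rowIncr' : ∀ r c c' → Ins r c → Ins r c' → c < c' → F' r c ≤[ I' ] F' r c'
      rowIncr' r c c' s s' c<c' with m≤n⇒m<n∨m≡n (≤-val (rowIncr r c c' s s' c<c'))
      ... | inj₁ v< = strict-≤ s s' v<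
      ... | inj₂ e with change (v r c)
      ...   | kept k      = kept-≤ s s' e k (rowIncr r c c' s s' c<c')
      ...   | dropped t f = ≤-max-unprimed (F' r c) (F' r c') (F'-val≡ s s' e) (I'-at s f) (dropped-row s s' c<c' e t f)
      ...   | added f t   = min-unprimed-≤ (F' r c) (F' r c') (F'-val≡ s s' e) (I'-at s t) (added-row s s' c<c' e f t)

      colIncr' : ∀ r r' c → Ins r c → Ins r' c → r < r' → F' r c ≤[ I' ] F' r' c
      colIncr' r r' c s s' r<r' with m≤n⇒m<n∨m≡n (≤-val (colIncr r r' c s s' r<r'))
      ... | inj₁ v< = strict-≤ s s' v<
      ... | inj₂ e with change (v r c)
      ...   | kept k      = kept-≤ s s' e k (colIncr r r' c s s' r<r')
      ...   | dropped t f = min-primed-≤ (F' r c) (F' r' c) (F'-val≡ s s' e) (I'-at s f) (dropped-col s s' r<r' e t f)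
      ...   | added f t   = ≤-max-primed (F' r c) (F' r' c) (F'-val≡ s s' e) (I'-at s t) (added-col s s' r<r' e f t)

      rowPrime' : ∀ r c c' → Ins r c → Ins r c' → c < c' → F' r c ≡ F' r c' → primed (F' r c) ≡ false
      rowPrime' r c c' s s' c<c' eq with change (v r c)
      ... | kept k      = kept-primed s s' k eq (rowPrime r c c' s s' c<c')
      ... | dropped t f = trans (cong primed eq) (dropped-row s s' c<c' (F'≡⇒v≡ s s' eq) t f)
      ... | added f t   = added-row s s' c<c' (F'≡⇒v≡ s s' eq) f t

      colUnpr' : ∀ r r' c → Ins r c → Ins r' c → r < r' → F' r c ≡ F' r' c → primed (F' r c) ≡ true
      colUnpr' r r' c s s' r<r' eq with change (v r c)
      ... | kept k      = kept-primed s s' k eq (colUnpr r r' c s s' r<r')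
      ... | dropped t f = dropped-col s s' r<r' (F'≡⇒v≡ s s' eq) t f
      ... | added f t   = trans (cong primed eq) (added-col s s' r<r' (F'≡⇒v≡ s s' eq) f t)

-- (8) The bijection: rotation for I → I' with inverse the rotation for I' → I.

module Rotation (la mu : List ℕ) (pla : IsPartition la) (pmu : IsPartition mu) where

  open Snapshot la mu
  open CellList la mu

  values : Filling → ℕ → ℕ → ℕ
  values F r c = val (F r c)

  module StripsOf (J : Subset) (T : QTab la mu J) =
    TableauStrips la mu pla pmu J (proj₁ T) (proj₂ T) (entry (snapshot (values (proj₁ T))))
                  (entry-snapshot pla (values (proj₁ T)))

  rotate : ∀ J J' → QTab la mu J → QTab la mu J'
  rotate J J' T = StripsOf.Rotated.F' J T J' , StripsOf.Rotated.isQTab J T J'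

  -- Tableaux agreeing on λ/μ have equal snapshots, hence the same shift.
  rotate-cong : ∀ J J' {T U : QTab la mu J} → _≈Q_ {la} {mu} T U →
                _≈Q_ {la} {mu} (rotate J J' T) (rotate J J' U)
  rotate-cong J J' {F , _} {G , isG} T≈U r c s =
    trans (cong (F at_) sameShift) (T≈U _ _ (StripsOf.Rotated.σ-inside J (G , isG) J' s))
    where
    sameShift : Strips.shift la mu (entry (snapshot (values F))) J J' (r , c) ≡
                Strips.shift la mu (entry (snapshot (values G))) J J' (r , c)
    sameShift = cong (λ t → Strips.shift la mu (entry t) J J' (r , c))
                     (snapshot-cong (values F) (values G) (λ r c s → cong val (T≈U r c s)))

  -- Rotating back undoes a rotation: the rotated tableau has the same values, hence the
  -- same strips, and shift J' J inverts shift J J'.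
  rotate-back : ∀ J J' (T : QTab la mu J) → _≈Q_ {la} {mu} (rotate J' J (rotate J J' T)) T
  rotate-back J J' T@(F , _) r c s =
    trans (cong (F' at_) sameShift) (cong (F at_) (shift-inverse J' J (r , c) s))
    where
    open StripsOf J T
    open Rotated J'
    sameShift : Strips.shift la mu (entry (snapshot (values F'))) J' J (r , c) ≡ shift J' J (r , c)
    sameShift = cong (λ t → Strips.shift la mu (entry t) J' J (r , c))
                     (snapshot-cong (values F') (values F) (λ r c s → val-F' s))

  rotation : ∀ J J' → Bijection (𝐐 la mu J) (𝐐 la mu J')
  rotation J J' = record
    { to        = rotate J J'
    ; cong      = λ {T} {U} → rotate-cong J J' {T} {U}
    ; bijective = (λ {T} {U} → injective {T} {U}) , surjective
    }
    where
    injective : ∀ {T U} → _≈Q_ {la} {mu} (rotate J J' T) (rotate J J' U) → _≈Q_ {la} {mu} T U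
    injective {T} {U} eq r c s =
      trans (sym (rotate-back J J' T r c s))
            (trans (rotate-cong J' J {rotate J J' T} {rotate J J' U} eq r c s) (rotate-back J J' U r c s))
    surjective : ∀ U → Σ (QTab la mu J) λ T → ∀ {T'} → _≈Q_ {la} {mu} T' T → _≈Q_ {la} {mu} (rotate J J' T') U
    surjective U = rotate J' J U , λ {T'} eq r c s →
      trans (rotate-cong J J' {T'} {rotate J' J U} eq r c s) (rotate-back J' J U r c s)

  -- wt is preserved because values are preserved cell by cell.
  rotate-wt : ∀ J J' (T : QTab la mu J) i → wt {la} {mu} (rotate J J' T) i ≡ wt {la} {mu} T i
  rotate-wt J J' T i = count-value-cong _ _ i (cells la mu) (λ x∈ → val-F' (cells-sound x∈))
    where
    open StripsOf J T
    open Rotated J'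

  -- P is preserved because σ permutes the cells of λ/μ, with inverse shift J' J.
  rotate-P : ∀ J J' (T : QTab la mu J) → P {la} {mu} (rotate J J' T) ≡ P {la} {mu} T
  rotate-P J J' T@(F , _) =
    count-permute (λ x → primed (F at x) B.≟ true) σ (shift J' J) (cells la mu) cells-unique
      (λ x∈ → cells-complete (σ-inside (cells-sound x∈)))
      (λ x∈ → cells-complete (proj₁ (proj₂ (shift-same J' J _ (cells-sound x∈)))))
      (λ x∈ → shift-inverse J' J _ (cells-sound x∈))
      (λ x∈ → shift-inverse J J' _ (cells-sound x∈))
    where
    open StripsOf J T
    open Rotated J'

mainTheorem7 : (n : ℕ) → 1 ≤ n → (la mu : List ℕ) → IsPartition la → IsPartition mu →
    mu ⊆P la → mu ⊆P staircase n → length la ≤ n → (I I' : Subset) →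
    Σ (Bijection (𝐐 la mu I) (𝐐 la mu I')) λ φ →
    (∀ T → (∀ i → wt (Bijection.to φ T) i ≡ wt T i) × P (Bijection.to φ T) ≡ P T)
mainTheorem7 n _ la mu pla pmu _ _ _ I I' =
  rotation I I' , λ T → rotate-wt I I' T , rotate-P I I' T
  where
  open Rotation la mu pla pmu
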